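{- Let $R$ and $S$ be TRSs over $\Sigma$ and $T\subseteq\mathcal{T}(\Sigma,\emptyset)$. Then $R$ is terminating relative to $S$ on $T$ if and only if there is an extended well-founded monotone partial $\Sigma$-algebra $(A,[\![\cdot]\!],\succ,\sqsupseteq)$ such that $T$ is defined (i.e. $[\![t]\!]$ is defined for all $t\in T$), $\succ$ is a partial model for $R$, and $\sqsupseteq$ is a partial model for $S$.
   Context: A TRS over $\Sigma$ is a set of rules $\ell\to r$ ($\ell\notin\mathcal{X}$, $\mathrm{Var}(r)\subseteq\mathrm{Var}(\ell)$) with usual one-step rewrite relation $\to_R$. For relations $\to_1,\to_2$ on a set $A$, $\to_1$ is terminating relative to $\to_2$ on $B\subseteq A$ if $\to_2^*\cdot\to_1\cdot\to_2^*$ admits no infinite sequence starting in $B$. $R$ is terminating relative to $S$ on $T$ if $\to_R$ is terminating relative to $\to_S$ on $T$. A partial $\Sigma$-algebra $(A,[\![\cdot]\!])$: non-empty $A$, partial functions $[\![f]\!]:A^n\rightharpoonup A$; term interpretation under $\alpha:\mathcal{X}\to A$: $[\![x]\!]_\alpha=\alpha(x)$, $[\![f(t_1,\dots,t_n)]\!]_\alpha=[\![f]\!]([\![t_1]\!]_\alpha,\dots,[\![t_n]\!]_\alpha)$, defined only if all subexpressions are; $[\![t]\!]$ for ground $t$. A partial function is closed w.r.t. relation $\rho$ if $f(\dots,a,\dots)$ defined and $a\,\rho\,b$ imply $f(\dots,b,\dots)$ defined; monotone w.r.t. $\rho$ if $f(\dots,a,\dots)$, $f(\dots,b,\dots)$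 defined and $a\,\rho\,b$ imply $f(\dots,a,\dots)\,\rho\,f(\dots,b,\dots)$ (all positions). An extended well-founded monotone partial $\Sigma$-algebra $(A,[\![\cdot]\!],\succ,\sqsupseteq)$ is a partial $\Sigma$-algebra with relations $\succ,\sqsupseteq$ on $A$ such that every $[\![f]\!]$ is closed and monotone w.r.t. both $\succ$ and $\sqsupseteq$, and $\succ$ is terminating relative to $\sqsupseteq$ on $A$. A relation $\rho$ is a partial model for a TRS $R$ if for all $\ell\to r\in R$ and $\alpha:\mathrm{Var}(\ell)\to A$ with $[\![\ell]\!]_\alpha$ defined, $[\![\ell]\!]_\alpha\,\rho\,[\![r]\!]_\alpha$. -}

module Defs where

open import Data.Nat using (ℕ; zero; suc)
open import Data.Fin using (Fin)
open import Data.Vec using (Vec; []; _∷_; lookup; _[_]≔_)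
open import Data.Product using (Σ; ∃; _×_; _,_)
open import Data.Empty using (⊥)
open import Data.Unit using (⊤)
open import Relation.Nullary using (¬_)
open import Relation.Binary.PropositionalEquality using (_≡_; _≢_)
open import Relation.Binary.Construct.Closure.ReflexiveTransitive using (Star)

RelStep : {A : Set} → (A → A → Set) → (A → A → Set) → A → A → Set
RelStep R₁ R₂ a b =
  Σ _ λ c → Σ _ λ d → Star R₂ a c × R₁ c d × Star R₂ d b

RelTerminatingOn : {A : Set} → (A → A → Set) → (A → A → Set) → (A → Set) → Set
RelTerminatingOn {A} R₁ R₂ B =
  ¬ (Σ (ℕ → A) λ s → B (s zero) × (∀ n → RelStep R₁ R₂ (s n) (s (suc n))))

record Signature : Set₁ where
  field
    Sym : Set
    ar  : Sym → ℕ
open Signature public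

module _ (Sg : Signature) where

  data Term : Set where
    var : ℕ → Term
    fun : (f : Sym Sg) → Vec Term (ar Sg f) → Term

  mutual
    data _∈V_ (x : ℕ) : Term → Set where
      here : x ∈V var x
      there : ∀ {f ts} → x ∈Vs ts → x ∈V fun f ts

    data _∈Vs_ (x : ℕ) : ∀ {n} → Vec Term n → Set where
      hd : ∀ {n t} {ts : Vec Term n} → x ∈V t → x ∈Vs (t ∷ ts)
      tl : ∀ {n t} {ts : Vec Term n} → x ∈Vs ts → x ∈Vs (t ∷ ts)

  Ground : Term → Set
  Ground t = ∀ x → ¬ (x ∈V t)

  mutual
    subst : (ℕ → Term) → Term → Term
    subst σ (var x) = σ x
    subst σ (fun f ts) = fun f (substs σ ts)

    substs : ∀ {n} → (ℕ → Term) → Vec Term n → Vec Term n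
    substs σ [] = []
    substs σ (t ∷ ts) = subst σ t ∷ substs σ ts

  record Rule : Set where
    constructor _⟶_⟨_,_⟩
    field
      lhs : Term
      rhs : Term
      lhs-nonvar : ∀ x → lhs ≢ var x
      vars-ok : ∀ x → x ∈V rhs → x ∈V lhs
  open Rule public

  TRS : Set₁
  TRS = Rule → Set

  data Step (R : TRS) : Term → Term → Set where
    root : ∀ {ρ} → R ρ → (σ : ℕ → Term) →
           Step R (subst σ (lhs ρ)) (subst σ (rhs ρ))
    inner : ∀ {f} (ts : Vec Term (ar Sg f)) (i : Fin (ar Sg f)) {u} →
            Step R (lookup ts i) u →
            Step R (fun f ts) (fun f (ts [ i ]≔ u))

  TRSRelTerminatingOn : TRS → TRS → (Term → Set) → Set
  TRSRelTerminatingOn R S T = RelTerminatingOn (Step R) (Step S) T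

  -- Partial Σ-algebras.  A partial function [[f]] : Aⁿ ⇀ A is given by
  -- its domain and a value on the domain that is independent of the
  -- (irrelevant) proof of definedness.

  record PartialAlgebra : Set₁ where
    field
      Carrier : Set
      point   : Carrier
      dom     : (f : Sym Sg) → Vec Carrier (ar Sg f) → Set
      app     : (f : Sym Sg) (as : Vec Carrier (ar Sg f)) → .(dom f as) → Carrier

  module _ (𝔄 : PartialAlgebra) where
    open PartialAlgebra 𝔄

    -- [[t]]_α = a   (defined iff some a exists)
    mutual
      data Eval (α : ℕ → Carrier) : Term → Carrier → Set where
        evar : ∀ x → Eval α (var x) (α x)
        efun : ∀ {f ts as} → Evals α ts as → (d : dom f as) →
               Eval α (fun f ts) (app f as d)

      data Evals (α : ℕ → Carrier) : ∀ {n} → Vec Term n → Vec Carrier n → Set where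
        [] : Evals α [] []
        _∷_ : ∀ {n t a} {ts : Vec Term n} {as} →
              Eval α t a → Evals α ts as → Evals α (t ∷ ts) (a ∷ as)

    -- [[t]] is defined (for ground t the assignment is irrelevant)
    GroundDefined : Term → Set
    GroundDefined t = ∃ λ a → Eval (λ _ → point) t a

    Closed : (Carrier → Carrier → Set) → Set
    Closed ρ = ∀ f (as : Vec Carrier (ar Sg f)) (i : Fin (ar Sg f)) b →
      dom f as → ρ (lookup as i) b → dom f (as [ i ]≔ b)

    Monotone : (Carrier → Carrier → Set) → Set
    Monotone ρ = ∀ f (as : Vec Carrier (ar Sg f)) (i : Fin (ar Sg f)) b →
      (d₁ : dom f as) (d₂ : dom f (as [ i ]≔ b)) → ρ (lookup as i) b →
      ρ (app f as d₁) (app f (as [ i ]≔ b) d₂)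

    PartialModel : (Carrier → Carrier → Set) → TRS → Set
    PartialModel ρ R = ∀ rl → R rl → (α : ℕ → Carrier) → ∀ a →
      Eval α (lhs rl) a → ∃ λ b → Eval α (rhs rl) b × ρ a b

  record ExtWFMonotonePartialAlgebra : Set₁ where
    field
      algebra : PartialAlgebra
      _≻_ : PartialAlgebra.Carrier algebra → PartialAlgebra.Carrier algebra → Set
      _⊒_ : PartialAlgebra.Carrier algebra → PartialAlgebra.Carrier algebra → Set
      closed-≻ : Closed algebra _≻_
      closed-⊒ : Closed algebra _⊒_
      monotone-≻ : Monotone algebra _≻_
      monotone-⊒ : Monotone algebra _⊒_
      rel-terminating : RelTerminatingOn _≻_ _⊒_ (λ _ → ⊤)

-- (⇐) Evaluating a relative rewrite sequence that starts in T yields an infinite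
-- ⊒* · ≻ · ⊒* sequence of values: closedness keeps every term of the sequence
-- defined, and monotonicity together with the two partial models relates
-- successive values. (⇒) Take as carrier the terms that are terminating relative
-- to S, let an operation be defined exactly when its result is again such a term,
-- and put ≻ = →R, ⊒ = →S; closedness is then the preservation of relative
-- termination under →R and →S steps.
module Submission where

open import Defs
open import Data.Empty using (⊥-elim; ⊥-elim-irr)
open import Data.Fin using () renaming (zero to fzero; suc to fsuc)
open import Data.Nat using (ℕ; zero; suc; _≟_)
open import Data.Product using (Σ; ∃; _×_; _,_; proj₁; proj₂)
open import Data.Sum using (inj₁; inj₂; [_,_])
open import Data.Unit using (tt)
open import Data.Vec using (Vec; []; _∷_; lookup; _[_]≔_; map)
open import Data.Vec.Properties using (lookup∘update; lookup-map; map-[]≔)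
open import Function using (_∘_)
open import Function.Bundles using (_⇔_; mk⇔)
open import Relation.Binary.Construct.Closure.ReflexiveTransitive using (Star; ε; _◅_)
open import Relation.Binary.PropositionalEquality as ≡ using (_≡_; _≢_; refl; sym; cong; cong₂; subst₂)
open import Relation.Nullary using (¬_; Dec; yes; no)
open import Relation.Nullary.Decidable using (map′; _⊎-dec_)

RelTerminatingAt : {A : Set} → (A → A → Set) → (A → A → Set) → A → Set
RelTerminatingAt R₁ R₂ a = RelTerminatingOn R₁ R₂ (_≡ a)

module _ {A : Set} {R₁ R₂ : A → A → Set} where

  terminatingOn⇒terminatingAt : ∀ {B a} → RelTerminatingOn R₁ R₂ B → B a →
                                RelTerminatingAt R₁ R₂ a
  terminatingOn⇒terminatingAt term Ba (s , refl , steps) = term (s , Ba , steps)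

  terminatingAt⇒terminatingOn : ∀ {B} → (∀ a → B a → RelTerminatingAt R₁ R₂ a) →
                                RelTerminatingOn R₁ R₂ B
  terminatingAt⇒terminatingOn term (s , Bs₀ , steps) = term (s zero) Bs₀ (s , refl , steps)

  private
    _∷ˢ_ : A → (ℕ → A) → ℕ → A
    (a ∷ˢ s) zero    = a
    (a ∷ˢ s) (suc n) = s n

  terminatingAt-step₁ : ∀ {a b} → R₁ a b → RelTerminatingAt R₁ R₂ a → RelTerminatingAt R₁ R₂ b
  terminatingAt-step₁ {a} r term (s , refl , steps) = term (a ∷ˢ s , refl , steps′)
    where
    steps′ : ∀ n → RelStep R₁ R₂ ((a ∷ˢ s) n) ((a ∷ˢ s) (suc n))
    steps′ zero    = _ , _ , ε , r , ε
    steps′ (suc n) = steps n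

  terminatingAt-step₂ : ∀ {a b} → R₂ a b → RelTerminatingAt R₁ R₂ a → RelTerminatingAt R₁ R₂ b
  terminatingAt-step₂ {a} r term (s , refl , steps) = term (a ∷ˢ (s ∘ suc) , refl , steps′)
    where
    steps′ : ∀ n → RelStep R₁ R₂ ((a ∷ˢ (s ∘ suc)) n) (s (suc n))
    steps′ zero with steps zero
    ... | c , d , r₂* , r₁ , r₂*′ = c , d , r ◅ r₂* , r₁ , r₂*′
    steps′ (suc n) = steps (suc n)

module _ {A B : Set} {R : A → A → Set} {S : B → B → Set} (_∼_ : A → B → Set)
         (simulate : ∀ {a a′ b} → R a a′ → a ∼ b → ∃ λ b′ → a′ ∼ b′ × S b b′) where

  simulate-star : ∀ {a a′ b} → Star R a a′ → a ∼ b → ∃ λ b′ → a′ ∼ b′ × Star S b b′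
  simulate-star ε a∼b = _ , a∼b , ε
  simulate-star (r ◅ rs) a∼b with simulate r a∼b
  ... | b′ , a′∼b′ , s with simulate-star rs a′∼b′
  ...   | b″ , a″∼b″ , ss = b″ , a″∼b″ , s ◅ ss

module _ {A B : Set} {R₁ R₂ : A → A → Set} {S₁ S₂ : B → B → Set} (_∼_ : A → B → Set)
         (simulate₁ : ∀ {a a′ b} → R₁ a a′ → a ∼ b → ∃ λ b′ → a′ ∼ b′ × S₁ b b′)
         (simulate₂ : ∀ {a a′ b} → R₂ a a′ → a ∼ b → ∃ λ b′ → a′ ∼ b′ × S₂ b b′) where

  simulate-relStep : ∀ {a a′ b} → RelStep R₁ R₂ a a′ → a ∼ b →
                     ∃ λ b′ → a′ ∼ b′ × RelStep S₁ S₂ b b′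
  simulate-relStep (_ , _ , r₂* , r₁ , r₂*′) a∼b
    with simulate-star _∼_ simulate₂ r₂* a∼b
  ... | c , c∼ , s₂* with simulate₁ r₁ c∼
  ...   | d , d∼ , s₁ with simulate-star _∼_ simulate₂ r₂*′ d∼
  ...     | b′ , a′∼b′ , s₂*′ = b′ , a′∼b′ , (c , d , s₂* , s₁ , s₂*′)

  terminatingAt-simulation : ∀ {a b} → a ∼ b → RelTerminatingAt S₁ S₂ b →
                             RelTerminatingAt R₁ R₂ a
  terminatingAt-simulation {b = b} a∼b term (s , refl , steps) =
    term (proj₁ ∘ image , refl , λ n → proj₂ (proj₂ (next n)))
    where
    image : ∀ n → ∃ (s n ∼_)
    next  : ∀ n → ∃ λ b′ → s (suc n) ∼ b′ × RelStep S₁ S₂ (proj₁ (image n)) b′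
    image zero    = b , a∼b
    image (suc n) = proj₁ (next n) , proj₁ (proj₂ (next n))
    next n = simulate-relStep (steps n) (proj₂ (image n))

module _ {A B : Set} {R₁ R₂ : A → A → Set} {S₁ S₂ : B → B → Set} where

  terminatingAt-map : (f : A → B) →
                      (∀ {a a′} → R₁ a a′ → S₁ (f a) (f a′)) →
                      (∀ {a a′} → R₂ a a′ → S₂ (f a) (f a′)) →
                      ∀ {a} → RelTerminatingAt S₁ S₂ (f a) → RelTerminatingAt R₁ R₂ a
  terminatingAt-map f hom₁ hom₂ =
    terminatingAt-simulation (λ a b → f a ≡ b)
      (λ { r refl → _ , refl , hom₁ r }) (λ { r refl → _ , refl , hom₂ r }) refl

module _ {Sg : Signature} where

  mutual
    _∈V?_ : ∀ x (t : Term Sg) → Dec (_∈V_ Sg x t)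
    x ∈V? var y    = map′ (λ { refl → here }) (λ { here → refl }) (x ≟ y)
    x ∈V? fun f ts = map′ there (λ { (there p) → p }) (x ∈Vs? ts)

    _∈Vs?_ : ∀ x {n} (ts : Vec (Term Sg) n) → Dec (_∈Vs_ Sg x ts)
    x ∈Vs? []       = no λ ()
    x ∈Vs? (t ∷ ts) = map′ [ hd , tl ] (λ { (hd p) → inj₁ p ; (tl p) → inj₂ p })
                           (x ∈V? t ⊎-dec x ∈Vs? ts)

  mutual
    subst-ground : ∀ {σ} (t : Term Sg) → Ground Sg t → subst Sg σ t ≡ t
    subst-ground (var x)    ground = ⊥-elim (ground x here)
    subst-ground (fun f ts) ground = cong (fun f) (substs-ground ts (λ x → ground x ∘ there))

    substs-ground : ∀ {σ n} (ts : Vec (Term Sg) n) → (∀ x → ¬ _∈Vs_ Sg x ts) →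
                    substs Sg σ ts ≡ ts
    substs-ground []       ground = refl
    substs-ground (t ∷ ts) ground =
      cong₂ _∷_ (subst-ground t (λ x → ground x ∘ hd)) (substs-ground ts (λ x → ground x ∘ tl))

  subst-nonvar : ∀ {σ x} (l : Term Sg) → (∀ y → l ≢ var y) → subst Sg σ l ≢ var x
  subst-nonvar (var y)    l≢var = ⊥-elim (l≢var y refl)
  subst-nonvar (fun f ts) _     ()

  Step-source-nonvar : ∀ {Q t u} → Step Sg Q t u → ∀ x → t ≢ var x
  Step-source-nonvar (root {ρ} _ σ) x = subst-nonvar (lhs ρ) (lhs-nonvar ρ)
  Step-source-nonvar (inner _ _ _)  x ()

  Star-var : ∀ {Q x t u} → Star (Step Sg Q) t u → t ≡ var x → u ≡ var x
  Star-var ε       t≡x = t≡x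
  Star-var (r ◅ _) t≡x = ⊥-elim (Step-source-nonvar r _ t≡x)

  Step-inner-map : ∀ {Q f} {C : Set} (g : C → Term Sg) (cs : Vec C (ar Sg f)) i {c} →
                   Step Sg Q (g (lookup cs i)) (g c) →
                   Step Sg Q (fun f (map g cs)) (fun f (map g (cs [ i ]≔ c)))
  Step-inner-map {Q} g cs i {c} r =
    ≡.subst (Step Sg Q _ ∘ fun _) (sym (map-[]≔ g cs i))
      (inner (map g cs) i (≡.subst (λ t → Step Sg Q t (g c)) (sym (lookup-map i g cs)) r))

  module _ {R S : TRS Sg} where

    var-terminating : ∀ x → RelTerminatingAt (Step Sg R) (Step Sg S) (var x)
    var-terminating x (s , s₀≡x , steps) with steps zero
    ... | _ , _ , s* , r , _ = Step-source-nonvar r x (Star-var s* s₀≡x)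

    -- A rewrite sequence of the i-th argument is one of the whole term.
    terminating-argument : ∀ {f} {ts : Vec (Term Sg) (ar Sg f)} i →
                           RelTerminatingAt (Step Sg R) (Step Sg S) (fun f ts) →
                           RelTerminatingAt (Step Sg R) (Step Sg S) (lookup ts i)
    terminating-argument {f} {ts} i =
      terminatingAt-simulation _∼_ simulate simulate (ts , refl , refl)
      where
      _∼_ : Term Sg → Term Sg → Set
      u ∼ t = ∃ λ us → t ≡ fun f us × lookup us i ≡ u
      simulate : ∀ {Q u u′ t} → Step Sg Q u u′ → u ∼ t → ∃ λ t′ → u′ ∼ t′ × Step Sg Q t t′
      simulate {u′ = u′} r (us , refl , refl) =
        _ , (us [ i ]≔ u′ , refl , lookup∘update i us u′) , inner us i r

module _ {Sg : Signature} (𝔄 : PartialAlgebra Sg) where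
  open PartialAlgebra 𝔄

  mutual
    Eval-functional : ∀ {α t a b} → Eval Sg 𝔄 α t a → Eval Sg 𝔄 α t b → a ≡ b
    Eval-functional (evar x)    (evar .x)     = refl
    Eval-functional (efun es d) (efun es′ d′) with Evals-functional es es′
    ... | refl = refl

    Evals-functional : ∀ {α n} {ts : Vec (Term Sg) n} {as bs} →
                       Evals Sg 𝔄 α ts as → Evals Sg 𝔄 α ts bs → as ≡ bs
    Evals-functional []       []         = refl
    Evals-functional (e ∷ es) (e′ ∷ es′) = cong₂ _∷_ (Eval-functional e e′) (Evals-functional es es′)

  Evals-lookup : ∀ {α n} {ts : Vec (Term Sg) n} {as} i → Evals Sg 𝔄 α ts as →
                 Eval Sg 𝔄 α (lookup ts i) (lookup as i)
  Evals-lookup fzero    (e ∷ _)  = e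
  Evals-lookup (fsuc i) (_ ∷ es) = Evals-lookup i es

  Evals-update : ∀ {α n} {ts : Vec (Term Sg) n} {as u b} i → Evals Sg 𝔄 α ts as →
                 Eval Sg 𝔄 α u b → Evals Sg 𝔄 α (ts [ i ]≔ u) (as [ i ]≔ b)
  Evals-update fzero    (_ ∷ es) e′ = e′ ∷ es
  Evals-update (fsuc i) (e ∷ es) e′ = e ∷ Evals-update i es e′

  module _ {α : ℕ → Carrier} {σ : ℕ → Term Sg} where

    mutual
      Eval-subst-var : ∀ {x l a} → _∈V_ Sg x l → Eval Sg 𝔄 α (subst Sg σ l) a →
                       ∃ (Eval Sg 𝔄 α (σ x))
      Eval-subst-var here      e           = _ , e
      Eval-subst-var (there p) (efun es _) = Evals-subst-var p es

      Evals-subst-var : ∀ {x n} {ts : Vec (Term Sg) n} {as} → _∈Vs_ Sg x ts →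
                        Evals Sg 𝔄 α (substs Sg σ ts) as → ∃ (Eval Sg 𝔄 α (σ x))
      Evals-subst-var (hd p) (e ∷ _)  = Eval-subst-var p e
      Evals-subst-var (tl p) (_ ∷ es) = Evals-subst-var p es

    -- Outside the variables of l the assignment is an arbitrary junk value.
    instance-assignment : ∀ l {a} → Eval Sg 𝔄 α (subst Sg σ l) a →
                          Σ (ℕ → Carrier) λ β → ∀ x → _∈V_ Sg x l → Eval Sg 𝔄 α (σ x) (β x)
    instance-assignment l e = β , agrees
      where
      β : ℕ → Carrier
      β x with x ∈V? l
      ... | yes p = proj₁ (Eval-subst-var p e)
      ... | no _  = point
      agrees : ∀ x → _∈V_ Sg x l → Eval Sg 𝔄 α (σ x) (β x)
      agrees x p with x ∈V? l
      ... | yes q = proj₂ (Eval-subst-var q e)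
      ... | no ¬p = ⊥-elim (¬p p)

    module _ {β : ℕ → Carrier} where

      mutual
        Eval-subst⁻ : ∀ l {a} → (∀ x → _∈V_ Sg x l → Eval Sg 𝔄 α (σ x) (β x)) →
                      Eval Sg 𝔄 α (subst Sg σ l) a → Eval Sg 𝔄 β l a
        Eval-subst⁻ (var x) agrees e =
          ≡.subst (Eval Sg 𝔄 β (var x)) (Eval-functional (agrees x here) e) (evar x)
        Eval-subst⁻ (fun f ts) agrees (efun es d) =
          efun (Evals-subst⁻ ts (λ x → agrees x ∘ there) es) d

        Evals-subst⁻ : ∀ {n} (ts : Vec (Term Sg) n) {as} →
                       (∀ x → _∈Vs_ Sg x ts → Eval Sg 𝔄 α (σ x) (β x)) →
                       Evals Sg 𝔄 α (substs Sg σ ts) as → Evals Sg 𝔄 β ts as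
        Evals-subst⁻ []       agrees []       = []
        Evals-subst⁻ (t ∷ ts) agrees (e ∷ es) =
          Eval-subst⁻ t (λ x → agrees x ∘ hd) e ∷ Evals-subst⁻ ts (λ x → agrees x ∘ tl) es

      mutual
        Eval-subst⁺ : ∀ r {b} → (∀ x → _∈V_ Sg x r → Eval Sg 𝔄 α (σ x) (β x)) →
                      Eval Sg 𝔄 β r b → Eval Sg 𝔄 α (subst Sg σ r) b
        Eval-subst⁺ (var x)    agrees (evar .x)   = agrees x here
        Eval-subst⁺ (fun f ts) agrees (efun es d) =
          efun (Evals-subst⁺ ts (λ x → agrees x ∘ there) es) d

        Evals-subst⁺ : ∀ {n} (ts : Vec (Term Sg) n) {bs} →
                       (∀ x → _∈Vs_ Sg x ts → Eval Sg 𝔄 α (σ x) (β x)) →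
                       Evals Sg 𝔄 β ts bs → Evals Sg 𝔄 α (substs Sg σ ts) bs
        Evals-subst⁺ []       agrees []       = []
        Evals-subst⁺ (t ∷ ts) agrees (e ∷ es) =
          Eval-subst⁺ t (λ x → agrees x ∘ hd) e ∷ Evals-subst⁺ ts (λ x → agrees x ∘ tl) es

  module _ {ρ : Carrier → Carrier → Set} {Q : TRS Sg}
           (closed : Closed Sg 𝔄 ρ) (monotone : Monotone Sg 𝔄 ρ)
           (model : PartialModel Sg 𝔄 ρ Q) {α : ℕ → Carrier} where

    Eval-step : ∀ {t u a} → Step Sg Q t u → Eval Sg 𝔄 α t a →
                ∃ λ b → Eval Sg 𝔄 α u b × ρ a b
    Eval-step (root {rl} Qrl σ) e =
      let β , agrees = instance-assignment (lhs rl) e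
          b , eb , aρb = model rl Qrl β _ (Eval-subst⁻ (lhs rl) agrees e)
      in b , Eval-subst⁺ (rhs rl) (λ x → agrees x ∘ vars-ok rl x) eb , aρb
    Eval-step (inner {f} ts i r) (efun {as = as} es d) =
      let b , eb , aρb = Eval-step r (Evals-lookup i es)
          d′ = closed f as i b d aρb
      in app f (as [ i ]≔ b) d′ , efun (Evals-update i es eb) d′ , monotone f as i b d d′ aρb

module _ {Sg : Signature} {R S : TRS Sg} (𝔄 : ExtWFMonotonePartialAlgebra Sg) where
  open ExtWFMonotonePartialAlgebra 𝔄
  open PartialAlgebra algebra

  partialModels⇒relTerminating : ∀ {T} → (∀ t → T t → GroundDefined Sg algebra t) →
                                 PartialModel Sg algebra _≻_ R → PartialModel Sg algebra _⊒_ S →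
                                 TRSRelTerminatingOn Sg R S T
  partialModels⇒relTerminating defined modelR modelS = terminatingAt⇒terminatingOn λ t Tt →
    terminatingAt-simulation (Eval Sg algebra (λ _ → point))
      (Eval-step algebra closed-≻ monotone-≻ modelR)
      (Eval-step algebra closed-⊒ monotone-⊒ modelS)
      (proj₂ (defined t Tt))
      (terminatingOn⇒terminatingAt rel-terminating tt)

module TermAlgebra {Sg : Signature} (R S : TRS Sg) where

  Terminating : Term Sg → Set
  Terminating = RelTerminatingAt (Step Sg R) (Step Sg S)

  Carrier : Set
  Carrier = Σ (Term Sg) Terminating

  algebra : PartialAlgebra Sg
  algebra = record
    { Carrier = Carrier
    ; point   = var 0 , var-terminating 0
    ; dom     = λ f as → Terminating (fun f (map proj₁ as))
    -- Relative termination is a negation, so it survives the irrelevance of d.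
    ; app     = λ f as d → fun f (map proj₁ as) , λ chain → ⊥-elim-irr (d chain)
    }

  CarrierStep : TRS Sg → Carrier → Carrier → Set
  CarrierStep Q a b = Step Sg Q (proj₁ a) (proj₁ b)

  extAlgebra : ExtWFMonotonePartialAlgebra Sg
  extAlgebra = record
    { algebra         = algebra
    ; _≻_             = CarrierStep R
    ; _⊒_             = CarrierStep S
    ; closed-≻        = λ f as i b d r → terminatingAt-step₁ (Step-inner-map proj₁ as i r) d
    ; closed-⊒        = λ f as i b d r → terminatingAt-step₂ (Step-inner-map proj₁ as i r) d
    ; monotone-≻      = λ f as i b _ _ r → Step-inner-map proj₁ as i r
    ; monotone-⊒      = λ f as i b _ _ r → Step-inner-map proj₁ as i r
    ; rel-terminating = terminatingAt⇒terminatingOn λ a _ →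
        terminatingAt-map proj₁ (λ r → r) (λ r → r) (proj₂ a)
    }

  module _ {α : ℕ → Carrier} where

    mutual
      Eval⇒subst : ∀ {t a} → Eval Sg algebra α t a → proj₁ a ≡ subst Sg (proj₁ ∘ α) t
      Eval⇒subst (evar x)    = refl
      Eval⇒subst (efun es _) = cong (fun _) (Evals⇒substs es)

      Evals⇒substs : ∀ {n} {ts : Vec (Term Sg) n} {as} → Evals Sg algebra α ts as →
                     map proj₁ as ≡ substs Sg (proj₁ ∘ α) ts
      Evals⇒substs []       = refl
      Evals⇒substs (e ∷ es) = cong₂ _∷_ (Eval⇒subst e) (Evals⇒substs es)

    mutual
      terminating⇒Eval : ∀ t → Terminating (subst Sg (proj₁ ∘ α) t) → ∃ (Eval Sg algebra α t)
      terminating⇒Eval (var x)    _    = _ , evar x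
      terminating⇒Eval (fun f ts) term =
        let as , es = terminating⇒Evals ts (λ i → terminating-argument i term)
        in _ , efun es (≡.subst Terminating (cong (fun f) (sym (Evals⇒substs es))) term)

      terminating⇒Evals : ∀ {n} (ts : Vec (Term Sg) n) →
                          (∀ i → Terminating (lookup (substs Sg (proj₁ ∘ α) ts) i)) →
                          ∃ (Evals Sg algebra α ts)
      terminating⇒Evals []       _    = [] , []
      terminating⇒Evals (t ∷ ts) term =
        let a , e = terminating⇒Eval t (term fzero)
            as , es = terminating⇒Evals ts (term ∘ fsuc)
        in a ∷ as , e ∷ es

  CarrierStep-partialModel : ∀ {Q} → (∀ {t u} → Step Sg Q t u → Terminating t → Terminating u) →
                      PartialModel Sg algebra (CarrierStep Q) Q
  CarrierStep-partialModel {Q} preserves rl Qrl α a el =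
    let lhs≡ = Eval⇒subst el
        rootStep = root Qrl (proj₁ ∘ α)
        b , er = terminating⇒Eval (rhs rl) (preserves rootStep (≡.subst Terminating lhs≡ (proj₂ a)))
    in b , er , subst₂ (Step Sg Q) (sym lhs≡) (sym (Eval⇒subst er)) rootStep

  groundDefined : ∀ {t} → Ground Sg t → Terminating t → GroundDefined Sg algebra t
  groundDefined {t} ground term =
    terminating⇒Eval t (≡.subst Terminating (sym (subst-ground t ground)) term)

relTerminating⇒partialModels : ∀ {Sg} {R S : TRS Sg} {T : Term Sg → Set} →
  (∀ t → T t → Ground Sg t) → TRSRelTerminatingOn Sg R S T →
  Σ (ExtWFMonotonePartialAlgebra Sg) λ 𝔄 →
    let open ExtWFMonotonePartialAlgebra 𝔄 in
    (∀ t → T t → GroundDefined Sg algebra t) ×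
    PartialModel Sg algebra _≻_ R ×
    PartialModel Sg algebra _⊒_ S
relTerminating⇒partialModels {R = R} {S} ground term =
  extAlgebra ,
  (λ t Tt → groundDefined (ground t Tt) (terminatingOn⇒terminatingAt term Tt)) ,
  CarrierStep-partialModel terminatingAt-step₁ ,
  CarrierStep-partialModel terminatingAt-step₂
  where open TermAlgebra R S

theorem4p6 : (Sg : Signature) (R S : TRS Sg) (T : Term Sg → Set) →
    (∀ t → T t → Ground Sg t) →
    TRSRelTerminatingOn Sg R S T ⇔
    Σ (ExtWFMonotonePartialAlgebra Sg) λ 𝔄 →
    let open ExtWFMonotonePartialAlgebra 𝔄 in
    (∀ t → T t → GroundDefined Sg algebra t) ×
    PartialModel Sg algebra _≻_ R ×
    PartialModel Sg algebra _⊒_ S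
theorem4p6 Sg R S T ground =
  mk⇔ (relTerminating⇒partialModels ground)
      (λ (𝔄 , defined , modelR , modelS) → partialModels⇒relTerminating 𝔄 defined modelR modelS)
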